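{- For every even positive integer $n$ and every integer $d$ with $0 \le d \le n-1$, there exists a $d$-regular graph on $n$ vertices that does not contain a $5$-cycle as an induced subgraph.
   Context: A graph is $d$-regular if every vertex has degree $d$. -}

module Defs where

open import Data.Nat using (ℕ; zero; suc; _+_; _*_; _≤_; _<_)
open import Data.Fin using (Fin; zero; suc; toℕ)
open import Data.Bool using (Bool; true; false; T)
open import Data.List using (List; length; filter)
open import Data.List using () renaming (allFin to allFinL)
open import Data.Product using (Σ; ∃; _×_; _,_)
open import Data.Unit using (⊤)
open import Data.Empty using (⊥)
open import Relation.Binary.PropositionalEquality using (_≡_)
open import Relation.Nullary using (¬_)
open import Relation.Nullary.Decidable using (Dec; yes; no)
open import Data.Bool.Properties using (T?)
open import Function.Definitions using (Injective)

record Graph (n : ℕ) : Set where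
  field
    adj   : Fin n → Fin n → Bool
    sym   : ∀ u v → adj u v ≡ adj v u
    irrefl : ∀ v → adj v v ≡ false
open Graph public

degree : ∀ {n} → Graph n → Fin n → ℕ
degree {n} G v = length (filter (λ u → T? (adj G v u)) (allFinL n))

Regular : ∀ {n} → ℕ → Graph n → Set
Regular d G = ∀ v → degree G v ≡ d

c5adj : Fin 5 → Fin 5 → Bool
c5adj i j = c5 (toℕ i) (toℕ j)
  where
  c5 : ℕ → ℕ → Bool
  c5 0 1 = true
  c5 1 0 = true
  c5 1 2 = true
  c5 2 1 = true
  c5 2 3 = true
  c5 3 2 = true
  c5 3 4 = true
  c5 4 3 = true
  c5 4 0 = true
  c5 0 4 = true
  c5 _ _ = false

HasInducedC5 : ∀ {n} → Graph n → Set
HasInducedC5 {n} G =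
  Σ (Fin 5 → Fin n) λ f → Injective _≡_ _≡_ f × (∀ i j → adj G (f i) (f j) ≡ c5adj i j)

-- For d ≤ k, take the bipartite circulant graph on two copies of ℤ/k in which a
-- and b from opposite sides are adjacent iff (a + b) mod k < d.  It is d-regular
-- and bipartite, and a bipartite graph has no induced 5-cycle (no odd cycle at all).
-- For d > k, take the complement of that graph for degree 2k - 1 - d ≤ k: the
-- complement of an e-regular graph on n vertices is (n - 1 - e)-regular, and since
-- C₅ is self-complementary, a graph has an induced C₅ iff its complement has one.
module Submission where

open import Defs hiding (sym)
open import Data.Nat using (ℕ; _*_; _<_; _∸_; _≤_)
open import Data.Product using (Σ; _×_)
open import Relation.Binary.PropositionalEquality using (_≡_)
open import Relation.Nullary using (¬_)

open import Data.Nat using (zero; suc; _+_; _<ᵇ_; NonZero; s≤s; _≤?_)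
open import Data.Nat.Properties
  using (+-comm; +-assoc; +-suc; +-identityʳ; +-cancelˡ-≡; +-cancelʳ-≡; +-cancelʳ-≤;
         m≤m+n; +-monoʳ-≤; module ≤-Reasoning; suc-injective;
         <⇒<ᵇ; <ᵇ⇒<; <⇒≱; <⇒≤; ≰⇒>; m≤n⇒m≤1+n; m∸n+n≡m)
open import Data.Nat.DivMod using (_%_; [m+n]%n≡m%n; m<n⇒m%n≡m)
open import Data.Fin using (Fin; zero; suc; toℕ; #_)
open import Data.Fin.Properties using (toℕ<n; _≟_; all?)
open import Data.Bool using (Bool; true; false; not; _∧_; _xor_; if_then_else_)
open import Data.Bool.Properties
  using (T?; T-≡; ¬-not; not-¬; not-injective; not-involutive; xor-comm; xor-same; xor-identityʳ)
import Data.Bool.Properties as Bool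
open import Data.List using (length; filter; tabulate)
open import Data.Product using (_,_)
open import Function using (_∘_; Equivalence)
open import Function.Definitions using (Injective)
open import Relation.Binary.PropositionalEquality using (_≢_; refl; sym; trans; cong; cong₂; module ≡-Reasoning)
open import Relation.Nullary using (yes; no; does; ¬?; _→-dec_)
open import Relation.Nullary.Decidable using (dec-true; dec-false; from-yes)

private
  variable
    m n : ℕ

count : (Fin n → Bool) → ℕ
count {zero}  p = 0
count {suc n} p = if p zero then suc (count (p ∘ suc)) else count (p ∘ suc)

count-cong : {p q : Fin n → Bool} → (∀ i → p i ≡ q i) → count p ≡ count q
count-cong {zero}  e = refl
count-cong {suc n} e rewrite e zero = cong (λ c → if _ then suc c else c) (count-cong (e ∘ suc))

count-false : ∀ n → count {n} (λ _ → false) ≡ 0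
count-false zero    = refl
count-false (suc n) = count-false n

count-not : (p : Fin n → Bool) → count (not ∘ p) + count p ≡ n
count-not {zero}  p = refl
count-not {suc n} p with p zero
... | false = cong suc (count-not (p ∘ suc))
... | true  = trans (+-suc _ _) (cong suc (count-not (p ∘ suc)))

count-remove : (p : Fin n → Bool) (v : Fin n) → p v ≡ true →
               suc (count (λ u → not (does (v ≟ u)) ∧ p u)) ≡ count p
count-remove p zero    pv rewrite pv = refl
count-remove p (suc v) pv with p zero
... | true  = cong suc (count-remove (p ∘ suc) v pv)
... | false = count-remove (p ∘ suc) v pv

count-∧-split : (b : Bool) (p : Fin n → Bool) →
                count (λ i → not b ∧ p i) + count (λ i → b ∧ p i) ≡ count p
count-∧-split {n} true  p = cong (_+ count p) (count-false n)
count-∧-split {n} false p = trans (cong (count p +_) (count-false n)) (+-identityʳ _)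

length-filter-tabulate : {A : Set} (f : Fin n → A) (p : A → Bool) →
                         length (filter (T? ∘ p) (tabulate f)) ≡ count (p ∘ f)
length-filter-tabulate {zero}  f p = refl
length-filter-tabulate {suc n} f p with p (f zero)
... | true  = cong suc (length-filter-tabulate (f ∘ suc) p)
... | false = length-filter-tabulate (f ∘ suc) p

degree≡count : (G : Graph n) (v : Fin n) → degree G v ≡ count (adj G v)
degree≡count G v = length-filter-tabulate (λ u → u) (adj G v)

countBelow : ℕ → (ℕ → Bool) → ℕ
countBelow n q = count {n} (q ∘ toℕ)

countBelow-+ : ∀ m n (q : ℕ → Bool) →
               countBelow (m + n) q ≡ countBelow m q + countBelow n (λ i → q (m + i))
countBelow-+ zero    n q = refl
countBelow-+ (suc m) n q with q 0
... | true  = cong suc (countBelow-+ m n (q ∘ suc))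
... | false = countBelow-+ m n (q ∘ suc)

countBelow-<ᵇ : ∀ {d k} → d ≤ k → countBelow k (_<ᵇ d) ≡ d
countBelow-<ᵇ {zero} {k}      _         = count-false k
countBelow-<ᵇ {suc d} {suc k} (s≤s d≤k) = cong suc (countBelow-<ᵇ d≤k)

countBelow-rotate : ∀ k (q : ℕ → Bool) → q k ≡ q 0 → countBelow k (q ∘ suc) ≡ countBelow k q
countBelow-rotate k q qk≡q0 = +-cancelˡ-≡ (countBelow 1 q) _ _ (begin
  countBelow 1 q + countBelow k (q ∘ suc)          ≡⟨ sym (countBelow-+ 1 k q) ⟩
  countBelow (1 + k) q                             ≡⟨ cong (λ l → countBelow l q) (+-comm 1 k) ⟩
  countBelow (k + 1) q                             ≡⟨ countBelow-+ k 1 q ⟩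
  countBelow k q + countBelow 1 (λ i → q (k + i))  ≡⟨ cong (λ b → countBelow k q + countBelow 1 (λ _ → b)) qk+0≡q0 ⟩
  countBelow k q + countBelow 1 q                  ≡⟨ +-comm (countBelow k q) _ ⟩
  countBelow 1 q + countBelow k q                  ∎)
  where
  open ≡-Reasoning
  qk+0≡q0 : q (k + 0) ≡ q 0
  qk+0≡q0 = trans (cong q (+-identityʳ k)) qk≡q0

countBelow-periodic : ∀ k (q : ℕ → Bool) → (∀ s → q (s + k) ≡ q s) →
                      ∀ i → countBelow k (λ j → q (i + j)) ≡ countBelow k q
countBelow-periodic k q periodic zero    = refl
countBelow-periodic k q periodic (suc i) = begin
  countBelow k (λ j → q (suc i + j))  ≡⟨ count-cong {k} (λ j → cong q (sym (+-suc i (toℕ j)))) ⟩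
  countBelow k (λ j → q (i + suc j))  ≡⟨ countBelow-rotate k (λ j → q (i + j)) qi+k≡qi+0 ⟩
  countBelow k (λ j → q (i + j))      ≡⟨ countBelow-periodic k q periodic i ⟩
  countBelow k q                      ∎
  where
  open ≡-Reasoning
  qi+k≡qi+0 : q (i + k) ≡ q (i + 0)
  qi+k≡qi+0 = trans (periodic i) (cong q (sym (+-identityʳ i)))

ProperTwoColouring : Graph n → (Fin n → Bool) → Set
ProperTwoColouring G c = ∀ u v → adj G u v ≡ true → c u ≡ not (c v)

twoColourable⇒¬inducedC5 : {G : Graph n} (c : Fin n → Bool) →
                           ProperTwoColouring G c → ¬ HasInducedC5 G
twoColourable⇒¬inducedC5 c proper (f , _ , f-adj) = not-¬ refl odd
  where
  colour : Fin 5 → Bool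
  colour = c ∘ f
  step : ∀ i j → c5adj i j ≡ true → colour i ≡ not (colour j)
  step i j ij = proper (f i) (f j) (trans (f-adj i j) ij)
  open ≡-Reasoning
  odd : colour (# 0) ≡ not (colour (# 0))
  odd = begin
    colour (# 0)              ≡⟨ step (# 0) (# 1) refl ⟩
    not (colour (# 1))        ≡⟨ cong not (step (# 1) (# 2) refl) ⟩
    not (not (colour (# 2)))  ≡⟨ not-involutive _ ⟩
    colour (# 2)              ≡⟨ step (# 2) (# 3) refl ⟩
    not (colour (# 3))        ≡⟨ cong not (step (# 3) (# 4) refl) ⟩
    not (not (colour (# 4)))  ≡⟨ not-involutive _ ⟩
    colour (# 4)              ≡⟨ step (# 4) (# 0) refl ⟩
    not (colour (# 0))        ∎

≟-sym : (u v : Fin n) → does (u ≟ v) ≡ does (v ≟ u)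
≟-sym u v with u ≟ v
... | yes u≡v = sym (dec-true (v ≟ u) (sym u≡v))
... | no  u≢v = sym (dec-false (v ≟ u) (u≢v ∘ sym))

complement : Graph n → Graph n
complement G = record
  { adj    = λ u v → not (does (u ≟ v)) ∧ not (adj G u v)
  ; sym    = λ u v → cong₂ (λ e a → not e ∧ not a) (≟-sym u v) (Graph.sym G u v)
  ; irrefl = λ v → cong (λ e → not e ∧ not (adj G v v)) (dec-true (v ≟ v) refl)
  }

complement-adj : (G : Graph n) {u v : Fin n} → u ≢ v → adj (complement G) u v ≡ not (adj G u v)
complement-adj G {u} {v} u≢v rewrite dec-false (u ≟ v) u≢v = refl

complement-regular : ∀ {d e} {G : Graph n} → Regular d G → suc (d + e) ≡ n → Regular e (complement G)
complement-regular {n} {d} {e} {G} regular n≡ v =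
  +-cancelʳ-≡ d _ _ (suc-injective (begin
    suc (degree (complement G) v + d)
      ≡⟨ cong₂ (λ x y → suc (x + y)) (degree≡count (complement G) v) d≡count ⟩
    suc (count (adj (complement G) v)) + count (adj G v)
      ≡⟨ cong (_+ count (adj G v)) (count-remove (not ∘ adj G v) v (cong not (irrefl G v))) ⟩
    count (not ∘ adj G v) + count (adj G v)
      ≡⟨ count-not (adj G v) ⟩
    n
      ≡⟨ sym n≡ ⟩
    suc (d + e)
      ≡⟨ cong suc (+-comm d e) ⟩
    suc (e + d) ∎))
  where
  open ≡-Reasoning
  d≡count : d ≡ count (adj G v)
  d≡count = trans (sym (regular v)) (degree≡count G v)

InducedCopy : (Fin m → Fin m → Bool) → Graph n → Set
InducedCopy {m} {n} P G = Σ (Fin m → Fin n) λ f → Injective _≡_ _≡_ f × (∀ i j → adj G (f i) (f j) ≡ P i j)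

complement-reflects-induced : {P : Fin m → Fin m → Bool} {G : Graph n} (τ : Fin m → Fin m) →
  Injective _≡_ _≡_ τ → (∀ i → P i i ≡ false) → (∀ i j → i ≢ j → P (τ i) (τ j) ≡ not (P i j)) →
  InducedCopy P (complement G) → InducedCopy P G
complement-reflects-induced {P = P} {G} τ τ-injective P-irrefl τ-complements (f , f-injective , f-adj) =
  f ∘ τ , τ-injective ∘ f-injective , adj-fτ
  where
  adj-fτ : ∀ i j → adj G (f (τ i)) (f (τ j)) ≡ P i j
  adj-fτ i j with i ≟ j
  ... | yes refl = trans (irrefl G _) (sym (P-irrefl i))
  ... | no  i≢j  = not-injective (begin
    not (adj G (f (τ i)) (f (τ j)))     ≡⟨ sym (complement-adj G (i≢j ∘ τ-injective ∘ f-injective)) ⟩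
    adj (complement G) (f (τ i)) (f (τ j)) ≡⟨ f-adj (τ i) (τ j) ⟩
    P (τ i) (τ j)                       ≡⟨ τ-complements i j i≢j ⟩
    not (P i j)                         ∎)
    where open ≡-Reasoning

-- i ↦ 2i mod 5 maps C₅ onto its complement.
c5-double : Fin 5 → Fin 5
c5-double zero                         = # 0
c5-double (suc zero)                   = # 2
c5-double (suc (suc zero))             = # 4
c5-double (suc (suc (suc zero)))       = # 1
c5-double (suc (suc (suc (suc zero)))) = # 3

c5-double-injective : Injective _≡_ _≡_ c5-double
c5-double-injective {i} {j} =
  from-yes (all? λ i → all? λ j → (c5-double i ≟ c5-double j) →-dec (i ≟ j)) i j

c5adj-irrefl : ∀ i → c5adj i i ≡ false
c5adj-irrefl = from-yes (all? λ i → c5adj i i Bool.≟ false)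

c5adj-double : ∀ i j → i ≢ j → c5adj (c5-double i) (c5-double j) ≡ not (c5adj i j)
c5adj-double = from-yes (all? λ i → all? λ j →
  ¬? (i ≟ j) →-dec (c5adj (c5-double i) (c5-double j) Bool.≟ not (c5adj i j)))

complement-reflects-inducedC5 : {G : Graph n} → HasInducedC5 (complement G) → HasInducedC5 G
complement-reflects-inducedC5 {G = G} =
  complement-reflects-induced {G = G} c5-double c5-double-injective c5adj-irrefl c5adj-double

<ᵇ-true : ∀ {a b} → a < b → (a <ᵇ b) ≡ true
<ᵇ-true a<b = Equivalence.to T-≡ (<⇒<ᵇ a<b)

<ᵇ-false : ∀ {a b} → b ≤ a → (a <ᵇ b) ≡ false
<ᵇ-false {a} {b} b≤a = ¬-not λ a<ᵇb → <⇒≱ (<ᵇ⇒< a b (Equivalence.from T-≡ a<ᵇb)) b≤a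

xor∧≡true⇒≡not : ∀ x y w → (x xor y) ∧ w ≡ true → x ≡ not y
xor∧≡true⇒≡not true  true  w ()
xor∧≡true⇒≡not true  false w _ = refl
xor∧≡true⇒≡not false true  w _ = refl
xor∧≡true⇒≡not false false w ()

-- Vertices 0 … k-1 form one side and k … 2k-1 the other; the residue test is on
-- a + b rather than b - a so that the relation is visibly symmetric.
module BipartiteCirculant (k d : ℕ) .{{_ : NonZero k}} where

  side : ℕ → Bool
  side a = a <ᵇ k

  window : ℕ → Bool
  window s = s % k <ᵇ d

  rel : ℕ → ℕ → Bool
  rel a b = (side a xor side b) ∧ window (a + b)

  graph : Graph (2 * k)
  graph = record
    { adj    = λ u v → rel (toℕ u) (toℕ v)
    ; sym    = λ u v → cong₂ _∧_ (xor-comm (side (toℕ u)) _) (cong window (+-comm (toℕ u) _))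
    ; irrefl = λ v → cong (_∧ window (toℕ v + toℕ v)) (xor-same (side (toℕ v)))
    }

  window-periodic : ∀ s → window (s + k) ≡ window s
  window-periodic s = cong (_<ᵇ d) ([m+n]%n≡m%n s k)

  countBelow-rel : d ≤ k → ∀ a → countBelow (2 * k) (rel a) ≡ d
  countBelow-rel d≤k a = begin
    countBelow (2 * k) (rel a)
      ≡⟨ cong (λ l → countBelow (k + l) (rel a)) (+-identityʳ k) ⟩
    countBelow (k + k) (rel a)
      ≡⟨ countBelow-+ k k (rel a) ⟩
    countBelow k (rel a) + countBelow k (λ j → rel a (k + j))
      ≡⟨ cong₂ _+_ (count-cong {k} (lower ∘ toℕ<n)) (count-cong {k} (upper ∘ toℕ)) ⟩
    countBelow k (λ j → not (side a) ∧ window (a + j)) + countBelow k (λ j → side a ∧ window (a + j))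
      ≡⟨ count-∧-split {k} (side a) _ ⟩
    countBelow k (λ j → window (a + j))
      ≡⟨ countBelow-periodic k window window-periodic a ⟩
    countBelow k window
      ≡⟨ count-cong {k} (λ j → cong (_<ᵇ d) (m<n⇒m%n≡m (toℕ<n j))) ⟩
    countBelow k (_<ᵇ d)
      ≡⟨ countBelow-<ᵇ d≤k ⟩
    d ∎
    where
    open ≡-Reasoning
    lower : ∀ {j} → j < k → rel a j ≡ not (side a) ∧ window (a + j)
    lower {j} j<k rewrite <ᵇ-true j<k = cong (_∧ window (a + j)) (xor-comm (side a) true)
    a+[k+j]≡a+j+k : ∀ j → a + (k + j) ≡ a + j + k
    a+[k+j]≡a+j+k j = trans (cong (a +_) (+-comm k j)) (sym (+-assoc a j k))
    upper : ∀ j → rel a (k + j) ≡ side a ∧ window (a + j)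
    upper j rewrite <ᵇ-false (m≤m+n k j) =
      cong₂ _∧_ (xor-identityʳ (side a)) (trans (cong window (a+[k+j]≡a+j+k j)) (window-periodic (a + j)))

  regular : d ≤ k → Regular d graph
  regular d≤k v = trans (degree≡count graph v) (countBelow-rel d≤k (toℕ v))

  ¬inducedC5 : ¬ HasInducedC5 graph
  ¬inducedC5 = twoColourable⇒¬inducedC5 {G = graph} (side ∘ toℕ)
    λ u v → xor∧≡true⇒≡not (side (toℕ u)) (side (toℕ v)) _

regular-C5-free : ∀ k d .{{_ : NonZero k}} → d < 2 * k →
                  Σ (Graph (2 * k)) λ G → Regular d G × ¬ HasInducedC5 G
regular-C5-free k d d<2k with d ≤? k
... | yes d≤k = graph , regular d≤k , ¬inducedC5
  where open BipartiteCirculant k d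
... | no  d≰k = complement graph
              , complement-regular {G = graph} (regular e≤k) e+d≡2k
              , ¬inducedC5 ∘ complement-reflects-inducedC5 {G = graph}
  where
  e : ℕ
  e = 2 * k ∸ suc d
  e+d≡2k : suc (e + d) ≡ 2 * k
  e+d≡2k = trans (sym (+-suc e d)) (m∸n+n≡m d<2k)
  e≤k : e ≤ k
  e≤k = +-cancelʳ-≤ (suc d) e k (begin
    e + suc d    ≡⟨ m∸n+n≡m d<2k ⟩
    k + (k + 0)  ≡⟨ cong (k +_) (+-identityʳ k) ⟩
    k + k        ≤⟨ +-monoʳ-≤ k (m≤n⇒m≤1+n (<⇒≤ (≰⇒> d≰k))) ⟩
    k + suc d    ∎)
    where open ≤-Reasoning
  open BipartiteCirculant k e

lemma5 : (n k d : ℕ) → n ≡ 2 * k → 0 < n → d ≤ n ∸ 1 →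
    Σ (Graph n) λ G → Regular d G × ¬ HasInducedC5 G
lemma5 .(2 * zero)  zero    d refl ()
lemma5 .(2 * suc k) (suc k) d refl _ d≤n∸1 = regular-C5-free (suc k) d (s≤s d≤n∸1)
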